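{- For all bilayer functions $g,h$: $g\le_{LT}h$ if and only if $g\le^1_{LT}h^\Game$.
   Context: A bilayer function is a partial multi-valued function $g\colon\subseteq\mathbb{N}\times\Lambda\rightrightarrows\mathbb{N}$ for some set $\Lambda$; arguments are written $(n\mid c)$ ($n$ public, $c$ secret input); $\mathrm{dom}_{\rm pub}(g)=\{n:\exists c\,(n\mid c)\in\mathrm{dom}(g)\}$. Game $\mathfrak{G}(f,g)$: Merlin first plays $(x_0\mid c_0)\in\mathrm{dom}(f)$; at round $n$ Arthur plays $\langle j,u_n\rangle$ ($j=0$: query $u_n\in\mathrm{dom}_{\rm pub}(g)$; $j=1$: terminate with output $u_n$); after a query Nimue plays $z_n$ with $(u_n\mid z_n)\in\mathrm{dom}(g)$ and Merlin plays $x_{n+1}\in g(u_n\mid z_n)$. Arthur sees only $x_0,x_1,\dots$; his strategy is a code of a partial computable function on finite sequences of naturals. Merlin and Nimue see everything and use arbitrary strategies. Arthur and Nimue win if Merlin violates the rules first or both obey and Arthur terminates with $u_n\in f(x_0\mid c_0)$. $f\le_{LT}g$ iff some Arthur–Nimue strategy wins against every Merlin strategy. The game $\mathfrak{G}(h)$ is the same game with target $h$ but without Merlin's first move (Arthur reads $x_1,x_2,\dots$); Arthur–Nimue win it if Merlin violates the rules first, or both obey and Arthur declares termination. $h^\Game$ is the bilayer function whose public input is a code $\tau$ of an Arthur strategy and whose secret input is a Nimue strategy $\eta$, with $(\tau\mid\eta)\in\mathrm{dom}(h^\Game)$ iff Arthur–Nimue following $(\tau\mid\eta)$ win $\mathfrak{G}(h)$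 against every Merlin strategy, and $u\in h^\Game(\tau\mid\eta)$ iff some play following $(\tau\mid\eta)$ where all players obey the rules ends with Arthur declaring termination with $u$. $f\le^1_{LT}g$ iff there are partial computable $H,K$ and a function $L$ such that for all $(n\mid c)\in\mathrm{dom}(f)$, $(H(n)\mid L(n,c))\in\mathrm{dom}(g)$ and $m\in g(H(n)\mid L(n,c))$ implies $K(n,m)\in f(n\mid c)$. -}

module Defs where

open import Data.Nat using (ℕ; zero; suc; _+_; _<_)
open import Data.Product using (Σ; _×_; _,_; proj₁; proj₂)
open import Data.List using (List; []; _∷_; _++_; [_])
open import Data.Unit using (⊤)
open import Relation.Nullary using (¬_)
open import Relation.Binary.PropositionalEquality using (_≡_)

tri : ℕ → ℕ
tri zero    = zero
tri (suc d) = tri d + suc d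

pair : ℕ → ℕ → ℕ
pair a b = tri (a + b) + b

-- enumerates (0,0),(1,0),(0,1),(2,0),(1,1),(0,2),... (inverse of pair)
unpair : ℕ → ℕ × ℕ
unpair zero = 0 , 0
unpair (suc n) with unpair n
... | zero  , b = suc b , 0
... | suc a , b = a , suc b

seqCode : List ℕ → ℕ
seqCode []       = 0
seqCode (x ∷ xs) = suc (pair x (seqCode xs))

-- Partial recursive functions (unary, via pairing), Kleene style,
-- extended with a primitive for the universal function of this very
-- numbering (the class of computed functions is still exactly the
-- partial computable functions).

data Code : Set where
  zeroC succC idC fstC sndC univC : Code
  compC  : Code → Code → Code
  pairC  : Code → Code → Code
  recC   : Code → Code → Code
  muC    : Code → Code

-- numbering ℕ → Code (fuel-bounded structural recursion; fuel suc n suffices)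
decodeF : ℕ → ℕ → Code
decodeF zero    n = zeroC
decodeF (suc f) n = dec (proj₁ (unpair n)) (proj₂ (unpair n))
  where
  l : ℕ → ℕ
  l r = proj₁ (unpair r)
  rr : ℕ → ℕ
  rr r = proj₂ (unpair r)
  dec : ℕ → ℕ → Code
  dec 0 r = zeroC
  dec 1 r = succC
  dec 2 r = idC
  dec 3 r = fstC
  dec 4 r = sndC
  dec 5 r = univC
  dec 6 r = compC (decodeF f (l r)) (decodeF f (rr r))
  dec 7 r = pairC (decodeF f (l r)) (decodeF f (rr r))
  dec 8 r = recC  (decodeF f (l r)) (decodeF f (rr r))
  dec 9 r = muC   (decodeF f r)
  dec _ r = zeroC

decode : ℕ → Code
decode n = decodeF (suc n) n

data Eval : Code → ℕ → ℕ → Set where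
  ev-zero : ∀ {x} → Eval zeroC x 0
  ev-succ : ∀ {x} → Eval succC x (suc x)
  ev-id   : ∀ {x} → Eval idC x x
  ev-fst  : ∀ {x} → Eval fstC x (proj₁ (unpair x))
  ev-snd  : ∀ {x} → Eval sndC x (proj₂ (unpair x))
  ev-univ : ∀ {x e a y} → unpair x ≡ (e , a) → Eval (decode e) a y → Eval univC x y
  ev-comp : ∀ {f g x y z} → Eval g x y → Eval f y z → Eval (compC f g) x z
  ev-pair : ∀ {f g x a b} → Eval f x a → Eval g x b → Eval (pairC f g) x (pair a b)
  ev-rec0 : ∀ {f g x a z} → unpair x ≡ (a , 0) → Eval f a z → Eval (recC f g) x z
  ev-recS : ∀ {f g x a y w z} → unpair x ≡ (a , suc y)
          → Eval (recC f g) (pair a y) w → Eval g (pair (pair a y) w) z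
          → Eval (recC f g) x z
  ev-mu   : ∀ {f x y} → Eval f (pair x y) 0
          → (∀ y′ → y′ < y → Σ ℕ λ k → Eval f (pair x y′) (suc k))
          → Eval (muC f) x y

φ : ℕ → ℕ → ℕ → Set
φ e x y = Eval (decode e) x y

record Bilayer : Set₁ where
  field
    Sec : Set
    dom : ℕ → Sec → Set
    val : ℕ → Sec → ℕ → Set
open Bilayer public

-- Arthur's strategy is a code τ; on the sequence xs of Merlin's
-- moves seen so far he plays φ τ (seqCode xs) = ⟨ j , u ⟩.  Nimue's strategy
-- is a function of Merlin's moves (everything else in the history is
-- determined by them); Merlin's (later) strategy is M : List ℕ → ℕ.
-- Win g τ η M Goal xs : starting from history xs, the play against g
-- reaches, in finitely many rounds, either a Merlin violation or Arthur's
-- termination with an output satisfying Goal, with nobody else violating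
-- the rules before.

module _ (g : Bilayer) (τ : ℕ) (η : List ℕ → Sec g) (M : List ℕ → ℕ)
         (Goal : ℕ → Set) where
  data Win : List ℕ → Set where
    win-term    : ∀ {xs u} → φ τ (seqCode xs) (pair 1 u) → Goal u → Win xs
    win-violate : ∀ {xs u} → φ τ (seqCode xs) (pair 0 u) → dom g u (η xs)
                → ¬ val g u (η xs) (M xs) → Win xs
    win-step    : ∀ {xs u} → φ τ (seqCode xs) (pair 0 u) → dom g u (η xs)
                → val g u (η xs) (M xs) → Win (xs ++ [ M xs ]) → Win xs

module _ (g : Bilayer) (τ : ℕ) (η : List ℕ → Sec g) (u : ℕ) where
  data Ends : List ℕ → Set where
    end  : ∀ {xs} → φ τ (seqCode xs) (pair 1 u) → Ends xs
    cont : ∀ {xs v x} → φ τ (seqCode xs) (pair 0 v) → dom g v (η xs)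
         → val g v (η xs) x → Ends (xs ++ [ x ]) → Ends xs

-- f ≤_LT g  (game 𝔊(f,g)): Merlin's first move (x₀ ∣ c₀), then M.

_≤LT_ : Bilayer → Bilayer → Set
f ≤LT g = Σ ℕ λ τ → Σ (Sec f → List ℕ → Sec g) λ η →
  ∀ (x₀ : ℕ) (c₀ : Sec f) → dom f x₀ c₀ →
  ∀ (M : List ℕ → ℕ) → Win g τ (η c₀) M (val f x₀ c₀) (x₀ ∷ [])

-- h^⅁ : public input a code τ of an Arthur strategy, secret input a Nimue
-- strategy η for 𝔊(h).
_^Game : Bilayer → Bilayer
h ^Game = record
  { Sec = List ℕ → Sec h
  ; dom = λ τ η → ∀ (M : List ℕ → ℕ) → Win h τ η M (λ _ → ⊤) []
  ; val = λ τ η u → Ends h τ η u []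
  }

-- f ≤¹_LT g : H = φ eH, K(n,m) = φ eK ⟨n,m⟩, L arbitrary.
_≤¹LT_ : Bilayer → Bilayer → Set
f ≤¹LT g = Σ ℕ λ eH → Σ ℕ λ eK → Σ (ℕ → Sec f → Sec g) λ L →
  ∀ (n : ℕ) (c : Sec f) → dom f n c →
  Σ ℕ λ t → φ eH n t × dom g t (L n c) ×
    (∀ (m : ℕ) → val g t (L n c) m →
       Σ ℕ λ k → φ eK (pair n m) k × val f n c k)

-- (⇒) From a winning (τ ∣ η) for 𝔊(g,h), the reduction plays on public input n the strategy τ with
-- Merlin's first move fixed to n (its index H(n) is computable from n by s-m-n) together with Nimue's
-- η(c, n ∷ ·). This wins 𝔊(h), and every output reached by a rule-abiding play already lies in
-- g(n ∣ c), since Merlin could have played exactly that play; so K just returns it.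
-- (⇐) Arthur reads x₀, runs the strategy H(x₀) on the rest of the history, passes its queries on, and
-- turns its termination with u into K(x₀, u). The u reached when H(x₀) wins are outputs of
-- h^⅁(H(x₀) ∣ L(x₀, c₀)), so K(x₀, u) ∈ g(x₀ ∣ c₀).

module Submission where

open import Defs
open import Data.Nat
open import Data.Nat.Properties
open import Data.Product using (Σ; _×_; _,_; proj₁; proj₂)
open import Data.Empty using (⊥-elim)
open import Data.Unit using (tt)
open import Data.List using (List; []; _∷_; _++_; [_]; length; drop)
open import Data.List.Properties using (length-++)
open import Function using (_∘_; id)
open import Relation.Nullary using (¬_; yes; no)
open import Relation.Binary.PropositionalEquality
  using (_≡_; refl; sym; trans; cong; cong₂; subst; subst₂)
open import Relation.Binary.Definitions using (tri<; tri≈; tri>)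

pair-suc-zero : ∀ b → pair (suc b) 0 ≡ suc (pair 0 b)
pair-suc-zero b rewrite +-identityʳ b | +-identityʳ (tri b + suc b) = +-suc (tri b) b

pair-suc : ∀ a b → pair a (suc b) ≡ suc (pair (suc a) b)
pair-suc a b rewrite +-suc a b = +-suc (tri (suc (a + b))) b

unpair-pair : ∀ a b → unpair (pair a b) ≡ (a , b)
unpair-pair a b = along (a + b) a b refl
  where
  along : ∀ s a b → a + b ≡ s → unpair (pair a b) ≡ (a , b)
  along zero    zero    zero    _ = refl
  along (suc s) (suc a) zero    e
    rewrite pair-suc-zero a
          | along s 0 a (suc-injective (trans (cong suc (sym (+-identityʳ a))) e)) = refl
  along s       a       (suc b) e
    rewrite pair-suc a b | along s (suc a) b (trans (sym (+-suc a b)) e) = refl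

pair-injectiveˡ : ∀ {a b a′ b′} → pair a b ≡ pair a′ b′ → a ≡ a′
pair-injectiveˡ {a} {b} {a′} {b′} e =
  trans (sym (cong proj₁ (unpair-pair a b)))
        (trans (cong (proj₁ ∘ unpair) e) (cong proj₁ (unpair-pair a′ b′)))

pair-injectiveʳ : ∀ {a b a′ b′} → pair a b ≡ pair a′ b′ → b ≡ b′
pair-injectiveʳ {a} {b} {a′} {b′} e =
  trans (sym (cong proj₂ (unpair-pair a b)))
        (trans (cong (proj₂ ∘ unpair) e) (cong proj₂ (unpair-pair a′ b′)))

n≤tri[n] : ∀ n → n ≤ tri n
n≤tri[n] zero    = z≤n
n≤tri[n] (suc n) = m≤n+m (suc n) (tri n)

a≤pair[a,b] : ∀ a b → a ≤ pair a b
a≤pair[a,b] a b = ≤-trans (≤-trans (m≤m+n a b) (n≤tri[n] (a + b))) (m≤m+n _ b)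

b≤pair[a,b] : ∀ a b → b ≤ pair a b
b≤pair[a,b] a b = m≤n+m b _

b<pair[1+a,b] : ∀ a b → b < pair (suc a) b
b<pair[1+a,b] a b = +-monoˡ-≤ b (≤-trans (s≤s z≤n) (m≤n+m (suc (a + b)) (tri (a + b))))

index : Code → ℕ
index zeroC       = pair 0 0
index succC       = pair 1 0
index idC         = pair 2 0
index fstC        = pair 3 0
index sndC        = pair 4 0
index univC       = pair 5 0
index (compC a b) = pair 6 (pair (index a) (index b))
index (pairC a b) = pair 7 (pair (index a) (index b))
index (recC a b)  = pair 8 (pair (index a) (index b))
index (muC a)     = pair 9 (index a)

pair[1+a,b]≰0 : ∀ a b → pair (suc a) b ≰ 0
pair[1+a,b]≰0 a b le = <⇒≱ (≤-trans (s≤s z≤n) (b<pair[1+a,b] a b)) le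

pair[1+a,b]≤1+n⇒b≤n : ∀ a b n → pair (suc a) b ≤ suc n → b ≤ n
pair[1+a,b]≤1+n⇒b≤n a b n le = ≤-pred (≤-trans (b<pair[1+a,b] a b) le)

components≤ : ∀ k a b n → pair (suc k) (pair a b) ≤ suc n → a ≤ n × b ≤ n
components≤ k a b n le = ≤-trans (a≤pair[a,b] a b) bound , ≤-trans (b≤pair[a,b] a b) bound
  where bound = pair[1+a,b]≤1+n⇒b≤n k (pair a b) n le

decodeF-index : ∀ f c → index c ≤ f → decodeF (suc f) (index c) ≡ c
decodeF-index f zeroC _ = refl
decodeF-index f succC _ = refl
decodeF-index f idC   _ = refl
decodeF-index f fstC  _ = refl
decodeF-index f sndC  _ = refl
decodeF-index f univC _ = refl
decodeF-index zero (compC a b) le = ⊥-elim (pair[1+a,b]≰0 5 (pair (index a) (index b)) le)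
decodeF-index zero (pairC a b) le = ⊥-elim (pair[1+a,b]≰0 6 (pair (index a) (index b)) le)
decodeF-index zero (recC a b)  le = ⊥-elim (pair[1+a,b]≰0 7 (pair (index a) (index b)) le)
decodeF-index zero (muC a)     le = ⊥-elim (pair[1+a,b]≰0 8 (index a) le)
decodeF-index (suc f) (compC a b) le
  rewrite unpair-pair 6 (pair (index a) (index b)) | unpair-pair (index a) (index b)
  = let (a≤f , b≤f) = components≤ 5 (index a) (index b) f le
    in cong₂ compC (decodeF-index f a a≤f) (decodeF-index f b b≤f)
decodeF-index (suc f) (pairC a b) le
  rewrite unpair-pair 7 (pair (index a) (index b)) | unpair-pair (index a) (index b)
  = let (a≤f , b≤f) = components≤ 6 (index a) (index b) f le
    in cong₂ pairC (decodeF-index f a a≤f) (decodeF-index f b b≤f)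
decodeF-index (suc f) (recC a b) le
  rewrite unpair-pair 8 (pair (index a) (index b)) | unpair-pair (index a) (index b)
  = let (a≤f , b≤f) = components≤ 7 (index a) (index b) f le
    in cong₂ recC (decodeF-index f a a≤f) (decodeF-index f b b≤f)
decodeF-index (suc f) (muC a) le rewrite unpair-pair 9 (index a)
  = cong muC (decodeF-index f a (pair[1+a,b]≤1+n⇒b≤n 8 (index a) f le))

decode-index : ∀ c → decode (index c) ≡ c
decode-index c = decodeF-index (index c) c ≤-refl

φ-index : ∀ c {x y} → Eval c x y → φ (index c) x y
φ-index c {x} {y} = subst (λ d → Eval d x y) (sym (decode-index c))

Eval-functional : ∀ {c x y y′} → Eval c x y → Eval c x y′ → y ≡ y′
Eval-functional ev-zero ev-zero = refl
Eval-functional ev-succ ev-succ = refl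
Eval-functional ev-id   ev-id   = refl
Eval-functional ev-fst  ev-fst  = refl
Eval-functional ev-snd  ev-snd  = refl
Eval-functional (ev-univ e d) (ev-univ e′ d′) with trans (sym e) e′
... | refl = Eval-functional d d′
Eval-functional (ev-comp d₁ d₂) (ev-comp d₁′ d₂′) with Eval-functional d₁ d₁′
... | refl = Eval-functional d₂ d₂′
Eval-functional (ev-pair d₁ d₂) (ev-pair d₁′ d₂′) =
  cong₂ pair (Eval-functional d₁ d₁′) (Eval-functional d₂ d₂′)
Eval-functional (ev-rec0 e d) (ev-rec0 e′ d′) with trans (sym e) e′
... | refl = Eval-functional d d′
Eval-functional (ev-rec0 e _) (ev-recS e′ _ _) with trans (sym e) e′
... | ()
Eval-functional (ev-recS e _ _) (ev-rec0 e′ _) with trans (sym e) e′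
... | ()
Eval-functional (ev-recS e r d) (ev-recS e′ r′ d′) with trans (sym e) e′
... | refl with Eval-functional r r′
... | refl = Eval-functional d d′
Eval-functional {y = y} {y′} (ev-mu d₀ below) (ev-mu d₀′ below′) with <-cmp y y′
... | tri< y<y′ _ _ = ⊥-elim (0≢1+n (Eval-functional d₀ (proj₂ (below′ y y<y′))))
... | tri≈ _ y≡y′ _ = y≡y′
... | tri> _ _ y>y′ = ⊥-elim (0≢1+n (Eval-functional d₀′ (proj₂ (below y′ y>y′))))

fst-pair : ∀ {a b} → Eval fstC (pair a b) a
fst-pair {a} {b} = subst (Eval fstC (pair a b)) (cong proj₁ (unpair-pair a b)) ev-fst

snd-pair : ∀ {a b} → Eval sndC (pair a b) b
snd-pair {a} {b} = subst (Eval sndC (pair a b)) (cong proj₂ (unpair-pair a b)) ev-snd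

constC : ℕ → Code
constC zero    = zeroC
constC (suc k) = compC succC (constC k)

constC-eval : ∀ k {x} → Eval (constC k) x k
constC-eval zero    = ev-zero
constC-eval (suc k) = ev-comp (constC-eval k) ev-succ

applyC : Code → Code → Code
applyC e a = compC univC (pairC e a)

applyC-eval : ∀ {E A x e a y} → Eval E x e → Eval A x a → φ e a y → Eval (applyC E A) x y
applyC-eval {e = e} {a} E A d = ev-comp (ev-pair E A) (ev-univ (unpair-pair e a) d)

predC : Code
predC = compC (recC zeroC (compC sndC fstC)) (pairC zeroC idC)

predC-eval : ∀ m → Eval predC (suc m) m
predC-eval m = ev-comp (ev-pair ev-zero ev-id) (rec (suc m))
  where
  rec : ∀ m → Eval (recC zeroC (compC sndC fstC)) (pair 0 m) (pred m)
  rec zero    = ev-rec0 (unpair-pair 0 0) ev-zero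
  rec (suc m) = ev-recS (unpair-pair 0 (suc m)) (rec m) (ev-comp (fst-pair {pair 0 m}) (snd-pair {0}))

branchC : Code → Code → Code
branchC F G = recC F (compC G (compC fstC fstC))

branchC-zero : ∀ {F G a y} → Eval F a y → Eval (branchC F G) (pair a 0) y
branchC-zero {a = a} = ev-rec0 (unpair-pair a 0)

branchC-one : ∀ {F G a w y} → Eval F a w → Eval G a y → Eval (branchC F G) (pair a 1) y
branchC-one {a = a} F G =
  ev-recS (unpair-pair a 1) (branchC-zero F) (ev-comp (ev-comp fst-pair fst-pair) G)

quoteC : Code → Code
quoteC c = constC (index c)

quoteCompC quotePairC : Code → Code → Code
quoteCompC A B = pairC (constC 6) (pairC A B)
quotePairC A B = pairC (constC 7) (pairC A B)

quoteCompC-eval : ∀ {A B x a b} → Eval A x (index a) → Eval B x (index b)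
                → Eval (quoteCompC A B) x (index (compC a b))
quoteCompC-eval A B = ev-pair (constC-eval 6) (ev-pair A B)

quotePairC-eval : ∀ {A B x a b} → Eval A x (index a) → Eval B x (index b)
                → Eval (quotePairC A B) x (index (pairC a b))
quotePairC-eval A B = ev-pair (constC-eval 7) (ev-pair A B)

quoteConstC : Code
quoteConstC = compC (recC zeroC (quoteCompC (quoteC succC) sndC)) (pairC zeroC idC)

quoteConstC-eval : ∀ n → Eval quoteConstC n (index (constC n))
quoteConstC-eval n = ev-comp (ev-pair ev-zero ev-id) (rec n)
  where
  rec : ∀ n → Eval (recC zeroC (quoteCompC (quoteC succC) sndC)) (pair 0 n) (index (constC n))
  rec zero    = ev-rec0 (unpair-pair 0 0) ev-zero
  rec (suc n) = ev-recS (unpair-pair 0 (suc n)) (rec n)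
    (quoteCompC-eval {a = succC} {b = constC n} (constC-eval (index succC)) (snd-pair {pair 0 n}))

fixFirstC : ℕ → Code → Code
fixFirstC n c = compC c (pairC (constC n) idC)

fixFirstC-eval : ∀ {n c x y} → Eval c (pair n x) y → Eval (fixFirstC n c) x y
fixFirstC-eval {n} = ev-comp (ev-pair (constC-eval n) ev-id)

smnC : Code → Code
smnC c = quoteCompC (quoteC c) (quotePairC quoteConstC (quoteC idC))

smnC-eval : ∀ c n → Eval (smnC c) n (index (fixFirstC n c))
smnC-eval c n =
  quoteCompC-eval {a = c} {b = pairC (constC n) idC} (constC-eval (index c))
    (quotePairC-eval {a = constC n} {b = idC} (quoteConstC-eval n) (constC-eval (index idC)))

setMove : ℕ → ℕ → (List ℕ → ℕ) → List ℕ → ℕ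
setMove l x M zs with length zs ≟ l
... | yes _ = x
... | no  _ = M zs

setMove-here : ∀ {x M} ys → setMove (length ys) x M ys ≡ x
setMove-here ys with length ys ≟ length ys
... | yes _   = refl
... | no  ≢-l = ⊥-elim (≢-l refl)

setMove-later : ∀ {l x M} zs → l < length zs → setMove l x M zs ≡ M zs
setMove-later {l} zs l< with length zs ≟ l
... | yes ≡l = ⊥-elim (<-irrefl (sym ≡l) l<)
... | no  _  = refl

length<length-snoc : ∀ (ys : List ℕ) x → length ys < length (ys ++ [ x ])
length<length-snoc ys x = ≤-trans (m<m+n (length ys) (s≤s z≤n)) (≤-reflexive (sym (length-++ ys)))

module _ (g : Bilayer) (τ : ℕ) (η : List ℕ → Sec g) where

  Win-cong : ∀ {M M′ Goal ys} → (∀ zs → length ys ≤ length zs → M zs ≡ M′ zs)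
           → Win g τ η M Goal ys → Win g τ η M′ Goal ys
  Win-cong agree (win-term e goal) = win-term e goal
  Win-cong {ys = ys} agree (win-violate {u = u} e d ¬v) =
    win-violate e d (¬v ∘ subst (val g u (η ys)) (sym (agree ys ≤-refl)))
  Win-cong {M} {M′} {Goal} {ys} agree (win-step {u = u} e d v w) =
    win-step e d (subst (val g u (η ys)) M≡M′ v)
      (subst (λ x → Win g τ η M′ Goal (ys ++ [ x ])) M≡M′
        (Win-cong (λ zs le → agree zs (≤-trans (<⇒≤ (length<length-snoc ys (M ys))) le)) w))
    where M≡M′ = agree ys ≤-refl

  query≢term : ∀ {ys} v u → φ τ (seqCode ys) (pair 0 v) → ¬ φ τ (seqCode ys) (pair 1 u)
  query≢term v u e e′ with pair-injectiveˡ {0} {v} {1} {u} (Eval-functional e e′)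
  ... | ()

  Win-term-goal : ∀ {M Goal ys u} → φ τ (seqCode ys) (pair 1 u) → Win g τ η M Goal ys → Goal u
  Win-term-goal {Goal = Goal} {u = u} e (win-term {u = u′} e′ goal) =
    subst Goal (pair-injectiveʳ {1} {u′} {1} {u} (Eval-functional e′ e)) goal
  Win-term-goal {u = u} e (win-violate {u = v} e′ _ _) = ⊥-elim (query≢term v u e′ e)
  Win-term-goal {u = u} e (win-step {u = v} e′ _ _ _)  = ⊥-elim (query≢term v u e′ e)

  Win-query-next : ∀ {M Goal ys v x} → φ τ (seqCode ys) (pair 0 v) → val g v (η ys) x
                 → Win g τ η (setMove (length ys) x M) Goal ys → Win g τ η M Goal (ys ++ [ x ])
  Win-query-next {v = v} e _ (win-term {u = u} e′ _) = ⊥-elim (query≢term v u e e′)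
  Win-query-next {ys = ys} {v} e v∈ (win-violate {u = u} e′ _ ¬v)
    with pair-injectiveʳ {0} {v} {0} {u} (Eval-functional e e′)
  ... | refl = ⊥-elim (¬v (subst (val g v (η ys)) (sym (setMove-here ys)) v∈))
  Win-query-next {M} {Goal} {ys} {x = x} e _ (win-step _ _ _ w) =
    Win-cong {M = setMove (length ys) x M}
      (λ zs le → setMove-later zs (≤-trans (length<length-snoc ys x) le))
      (subst (λ z → Win g τ η (setMove (length ys) x M) Goal (ys ++ [ z ])) (setMove-here ys) w)

  -- Merlin can replay any rule-abiding play, so its output must meet the goal.
  Ends-sound : ∀ {Goal ys u} → (∀ M → Win g τ η M Goal ys) → Ends g τ η u ys → Goal u
  Ends-sound win (end e) = Win-term-goal e (win (λ _ → 0))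
  Ends-sound {ys = ys} win (cont {x = x} e _ v ends) =
    Ends-sound (λ M → Win-query-next {M} e v (win (setMove (length ys) x M))) ends

  Win-reachable : ∀ {M Goal ys} → Win g τ η M Goal ys → Win g τ η M (λ u → Ends g τ η u ys) ys
  Win-reachable = reach id
    where
    reach : ∀ {M Goal ys zs} → (∀ {u} → Ends g τ η u zs → Ends g τ η u ys)
          → Win g τ η M Goal zs → Win g τ η M (λ u → Ends g τ η u ys) zs
    reach back (win-term {u = u} e _) = win-term e (back (end {u = u} e))
    reach back (win-violate e d ¬v)   = win-violate e d ¬v
    reach back (win-step e d v w)     = win-step e d v (reach (λ ends → back (cont e d v ends)) w)

-- Use sites give the implicit parameters explicitly: inferring them makes Agda normalise code
-- indices, which are astronomically large numerals.
module _ (h : Bilayer) {τ τ′ : ℕ} {η η′ : List ℕ → Sec h} {M M′ : List ℕ → ℕ}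
         {Goal Goal′ : ℕ → Set}
         (R : List ℕ → List ℕ → Set)
         (R-snoc : ∀ {xs ys} x → R xs ys → R (xs ++ [ x ]) (ys ++ [ x ]))
         (η-agree : ∀ {xs ys} → R xs ys → η′ ys ≡ η xs)
         (M-agree : ∀ {xs ys} → R xs ys → M′ ys ≡ M xs)
         (query : ∀ {xs ys u} → R xs ys → φ τ (seqCode xs) (pair 0 u)
                → φ τ′ (seqCode ys) (pair 0 u))
         (terminate : ∀ {xs ys u} → R xs ys → φ τ (seqCode xs) (pair 1 u) → Goal u
                    → Σ ℕ λ u′ → φ τ′ (seqCode ys) (pair 1 u′) × Goal′ u′)
  where

  Win-simulate : ∀ {xs ys} → R xs ys → Win h τ η M Goal xs → Win h τ′ η′ M′ Goal′ ys
  Win-simulate r (win-term e goal) = let (_ , e′ , goal′) = terminate r e goal in win-term e′ goal′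
  Win-simulate r (win-violate {u = u} e d ¬v) =
    win-violate (query {u = u} r e) (subst (dom h u) (sym (η-agree r)) d)
      (¬v ∘ subst₂ (val h u) (η-agree r) (M-agree r))
  Win-simulate {xs} {ys} r (win-step {u = u} e d v w) =
    win-step (query {u = u} r e) (subst (dom h u) (sym (η-agree r)) d)
      (subst₂ (val h u) (sym (η-agree r)) (sym (M-agree r)) v)
      (subst (λ x → Win h τ′ η′ M′ Goal′ (ys ++ [ x ])) (sym (M-agree r))
        (Win-simulate (R-snoc (M xs) r) w))

≤LT⇒≤¹LT-Game : ∀ g h → g ≤LT h → g ≤¹LT (h ^Game)
≤LT⇒≤¹LT-Game g h (τ , η , win) = index (smnC playC) , index sndC , L , reduce
  where
  playC : Code
  playC = applyC (constC τ) succC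

  L : ℕ → Sec g → List ℕ → Sec h
  L n c ys = η c (n ∷ ys)

  play-eval : ∀ {n ys y} → φ τ (seqCode (n ∷ ys)) y → φ (index (fixFirstC n playC)) (seqCode ys) y
  play-eval {n} {ys} e = φ-index (fixFirstC n playC)
    (fixFirstC-eval {n} {playC} (applyC-eval (constC-eval τ) (ev-succ {pair n (seqCode ys)}) e))

  module _ (n : ℕ) (c : Sec g) (d : dom g n c) where
    shift : ∀ {Goal′} → (∀ {u} → val g n c u → Goal′ u) → ∀ M
          → Win h (index (fixFirstC n playC)) (L n c) M Goal′ []
    shift {Goal′} weaken M =
      Win-simulate h {τ} {index (fixFirstC n playC)} {η c} {L n c} {M ∘ drop 1} {M}
        {val g n c} {Goal′}
        (λ xs ys → xs ≡ n ∷ ys) (λ { _ refl → refl }) (λ { refl → refl }) (λ { refl → refl })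
        (λ { refl e → play-eval {n} e })
        (λ { {u = u} refl e goal → u , play-eval {n} e , weaken goal })
        refl (win n c d (M ∘ drop 1))

  reduce : ∀ n c → dom g n c →
    Σ ℕ λ t → φ (index (smnC playC)) n t × dom (h ^Game) t (L n c) ×
      (∀ m → val (h ^Game) t (L n c) m → Σ ℕ λ k → φ (index sndC) (pair n m) k × val g n c k)
  reduce n c d =
    index (fixFirstC n playC) , φ-index (smnC playC) (smnC-eval playC n) , shift n c d (λ _ → tt) ,
    λ m ends → m , φ-index sndC (snd-pair {n} {m}) ,
               Ends-sound h (index (fixFirstC n playC)) (L n c) (shift n c d id) ends

headC tailC : Code
headC = compC fstC predC
tailC = compC sndC predC

-- On history x₀ ∷ xs: run the strategy H(x₀) on xs, pass its queries on, and answer its output u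
-- by K(x₀, u).
moveC prepareC : ℕ → Code
moveC eH    = applyC (applyC (constC eH) headC) tailC
prepareC eH = pairC (pairC headC (compC sndC (moveC eH))) (compC fstC (moveC eH))

arthurC : ℕ → ℕ → Code
arthurC eH eK =
  compC (branchC (pairC zeroC sndC) (pairC (constC 1) (applyC (constC eK) idC))) (prepareC eH)

prepareC-eval : ∀ {eH x₀ r t j u} → φ eH x₀ t → φ t r (pair j u)
              → Eval (prepareC eH) (suc (pair x₀ r)) (pair (pair x₀ u) j)
prepareC-eval {eH} {x₀} {r} {t} {j} {u} H↓ move↓ =
  ev-pair (ev-pair head (ev-comp move (snd-pair {j}))) (ev-comp move (fst-pair {j}))
  where
  head : Eval headC (suc (pair x₀ r)) x₀
  head = ev-comp (predC-eval (pair x₀ r)) (fst-pair {x₀})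
  move : Eval (moveC eH) (suc (pair x₀ r)) (pair j u)
  move = applyC-eval (applyC-eval (constC-eval eH) head H↓)
                     (ev-comp (predC-eval (pair x₀ r)) (snd-pair {x₀})) move↓

arthurC-query : ∀ {eH eK x₀ t xs u} → φ eH x₀ t → φ t (seqCode xs) (pair 0 u)
              → φ (index (arthurC eH eK)) (seqCode (x₀ ∷ xs)) (pair 0 u)
arthurC-query {eH} {eK} {x₀} {t} {xs} {u} H↓ move↓ =
  φ-index (arthurC eH eK)
    (ev-comp (prepareC-eval {j = 0} {u} H↓ move↓) (branchC-zero (ev-pair ev-zero (snd-pair {x₀}))))

arthurC-terminate : ∀ {eH eK x₀ t xs u k} → φ eH x₀ t → φ t (seqCode xs) (pair 1 u)
                  → φ eK (pair x₀ u) k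
                  → φ (index (arthurC eH eK)) (seqCode (x₀ ∷ xs)) (pair 1 k)
arthurC-terminate {eH} {eK} {x₀} {t} {xs} {u} H↓ move↓ K↓ =
  φ-index (arthurC eH eK)
    (ev-comp (prepareC-eval {j = 1} {u} H↓ move↓)
      (branchC-one (ev-pair ev-zero (snd-pair {x₀}))
                   (ev-pair (constC-eval 1) (applyC-eval (constC-eval eK) ev-id K↓))))

≤¹LT-Game⇒≤LT : ∀ g h → g ≤¹LT (h ^Game) → g ≤LT h
≤¹LT-Game⇒≤LT g h (eH , eK , L , reduce) = index (arthurC eH eK) , η′ , win
  where
  -- Arthur's history always starts with Merlin's first move; the first clause is never consulted.
  η′ : Sec g → List ℕ → Sec h
  η′ c []       = L 0 c []
  η′ c (x ∷ xs) = L x c xs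

  win : ∀ x₀ c₀ → dom g x₀ c₀ → ∀ M
      → Win h (index (arthurC eH eK)) (η′ c₀) M (val g x₀ c₀) (x₀ ∷ [])
  win x₀ c₀ d M =
    let (t , H↓ , winning , sound) = reduce x₀ c₀ d in
    Win-simulate h {t} {index (arthurC eH eK)} {L x₀ c₀} {η′ c₀} {M ∘ (x₀ ∷_)} {M}
      {λ u → Ends h t (L x₀ c₀) u []} {val g x₀ c₀}
      (λ xs ys → ys ≡ x₀ ∷ xs) (λ { _ refl → refl }) (λ { refl → refl }) (λ { refl → refl })
      (λ { {xs} {_} {u} refl → arthurC-query {eH} {eK} {x₀} {t} {xs} {u} H↓ })
      (λ { {xs} {_} {u} refl e ends →
             let (k , K↓ , k∈g) = sound u ends
             in k , arthurC-terminate {eH} {eK} {x₀} {t} {xs} {u} {k} H↓ e K↓ , k∈g })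
      refl (Win-reachable h t (L x₀ c₀) (winning (M ∘ (x₀ ∷_))))

mainTheorem7 : (g h : Bilayer) → (g ≤LT h → g ≤¹LT (h ^Game)) × (g ≤¹LT (h ^Game) → g ≤LT h)
mainTheorem7 g h = ≤LT⇒≤¹LT-Game g h , ≤¹LT-Game⇒≤LT g h
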